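{- For all $n \in \mathbb{N}$, $d \mid n$, and $r \in \{0,\ldots,n/d-1\}$, we have $\frac{1}{\deg_{n,d,r}(q)} = O\left(q^{ -e(n,d,r)}\right)$ as $q \to \infty$ over prime powers, where \[ e(n,d,r) = d\binom{r+1}{2} + \binom{n+1}{2} - d\binom{n/d+1}{2} + dr\left(\tfrac{n}{d}-1-r\right). \] Moreover, $e(n,d,r)$ is positive unless $d=1$ and $r=0$, and $e(n,1,0)=0$.
   Context: $[m]_q = 1+q+\cdots+q^{m-1}$, $[m]_q! = \prod_{i=1}^m[i]_q$, $\genfrac[]{0pt}{1}{m}{r}_q = [m]_q!/([r]_q![m-r]_q!)$, and $\deg_{n,d,r}(q) = q^{d\binom{r+1}{2}}\cdot\frac{\prod_{i=1}^n(q^i-1)}{\prod_{j=1}^{n/d}(q^{jd}-1)}\cdot\genfrac[]{0pt}{1}{n/d-1}{r}_{q^d}$. For functions $f,g$ on an infinite set $S \subset \mathbb{N}$ with values in $[0,\infty)$, $f = O(g)$ means there are a constant $m$ and $s_0$ with $f(s)\le m\,g(s)$ for all $s>s_0$ in $S$. -}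

module Defs where

open import Data.Nat as ℕ using (ℕ; zero; suc; _∸_; NonZero)
open import Data.Nat.Primality using (Prime)
open import Data.Nat.Combinatorics using (_C_)
open import Data.Integer as ℤ using (ℤ; +_; -[1+_])
open import Data.Rational as ℚ using (ℚ; 0ℚ; 1ℚ; _≤_; 1/_; ≢-nonZero)
open import Data.Rational.Properties using (_≟_)
open import Data.Product using (Σ; _×_)
open import Relation.Nullary using (yes; no)
open import Relation.Binary.PropositionalEquality using (_≡_)

ℕ→ℚ : ℕ → ℚ
ℕ→ℚ n = (+ n) ℚ./ 1

-- total reciprocal: inv 0 = 0, inv p = 1/p otherwise.
-- (Only ever applied to quantities that are nonzero for q ≥ 2.)
inv : ℚ → ℚ
inv p with p ≟ 0ℚ
... | yes _ = 0ℚ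
... | no p≢0 = 1/_ p {{≢-nonZero p≢0}}

pow : ℚ → ℕ → ℚ
pow x zero    = 1ℚ
pow x (suc k) = x ℚ.* pow x k

zpow : ℚ → ℤ → ℚ
zpow x (+ k)      = pow x k
zpow x -[1+ k ]   = inv (pow x (suc k))

prod1 : ℕ → (ℕ → ℚ) → ℚ
prod1 zero    f = 1ℚ
prod1 (suc n) f = prod1 n f ℚ.* f (suc n)

qint : ℕ → ℚ → ℚ
qint zero    q = 0ℚ
qint (suc m) q = qint m q ℚ.+ pow q m

qfact : ℕ → ℚ → ℚ
qfact m q = prod1 m (λ i → qint i q)

qbinom : ℕ → ℕ → ℚ → ℚ
qbinom m r q = qfact m q ℚ.* inv (qfact r q ℚ.* qfact (m ∸ r) q)

deg : (n d r : ℕ) → .{{_ : NonZero d}} → ℚ → ℚ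
deg n d r q =
  pow q (d ℕ.* (suc r C 2))
  ℚ.* (prod1 n (λ i → pow q i ℚ.- 1ℚ)
       ℚ.* inv (prod1 (n ℕ./ d) (λ j → pow q (j ℕ.* d) ℚ.- 1ℚ)))
  ℚ.* qbinom (n ℕ./ d ∸ 1) r (pow q d)

e : (n d r : ℕ) → .{{_ : NonZero d}} → ℤ
e n d r =
  + (d ℕ.* (suc r C 2)) ℤ.+ + (suc n C 2) ℤ.- + (d ℕ.* (suc (n ℕ./ d) C 2))
  ℤ.+ (+ d ℤ.* + r ℤ.* (+ (n ℕ./ d) ℤ.- ℤ.1ℤ ℤ.- + r))

IsPrimePower : ℕ → Set
IsPrimePower q = Σ ℕ λ p → Σ ℕ λ k → Prime p × q ≡ p ℕ.^ suc k

BigOPrimePowers : (ℕ → ℚ) → (ℕ → ℚ) → Set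
BigOPrimePowers f g =
  Σ ℚ λ m → Σ ℕ λ s₀ → ∀ s → IsPrimePower s → s₀ ℕ.< s → f s ≤ m ℚ.* g s

-- Write m = n/d, s = m - 1 - r and x = q^d. Over ℕ, deg_{n,d,r}(q) is the quotient of
-- q^(d·C(r+1,2)) · ∏_{i≤n} (q^i - 1) · [r+s]_x!  by  ∏_{j≤m} (q^(jd) - 1) · [r]_x! [s]_x!.
-- For q ≥ 2 each q^i - 1 lies between q^i/2 and q^i, and each [k]_x! between x^C(k,2) and
-- 2^k x^C(k,2); hence deg_{n,d,r}(q) ≥ 2^-(r+s+n) q^e. Since C(n+1,2) = d·C(m+1,2) + m²·C(d,2),
-- the exponent is e(n,d,r) = d·C(r+1,2) + m²·C(d,2) + d·r·s, which is visibly a natural number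
-- and vanishes only for d = 1, r = 0.
module Submission where

open import Defs
open import Data.Nat as ℕ
  using (ℕ; zero; suc; _+_; _*_; _^_; _∸_; _≤_; _<_; z≤n; s≤s; NonZero; _/_; >-nonZero; >-nonZero⁻¹)
open import Data.Nat.Properties
open import Data.Nat.Combinatorics using (_C_; nC1≡n; nCk+nC[k+1]≡[n+1]C[k+1])
open import Data.Nat.Coprimality using (1-coprimeTo) renaming (sym to coprime-sym)
open import Data.Nat.Divisibility using (_∣_; divides)
open import Data.Nat.DivMod using (m*n/n≡m; n/1≡n)
open import Data.Nat.Solver using (module +-*-Solver)
open import Data.Integer as ℤ using (ℤ; +_)
import Data.Integer.Properties as ℤP
import Data.Integer.Solver as ℤSolver
open import Data.Rational as ℚ using (ℚ; 0ℚ; 1ℚ; Positive)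
import Data.Rational.Properties as ℚP
import Data.Rational.Solver as ℚSolver
open import Data.Product using (_×_; _,_)
open import Relation.Nullary using (¬_; yes; no; contradiction)
open import Relation.Binary.PropositionalEquality

[1+k]C2≡k+kC2 : ∀ k → suc k C 2 ≡ k + k C 2
[1+k]C2≡k+kC2 k = trans (sym (nCk+nC[k+1]≡[n+1]C[k+1] k 1)) (cong (_+ k C 2) (nC1≡n k))

0<[2+k]C2 : ∀ k → 0 < suc (suc k) C 2
0<[2+k]C2 k = ≤-trans (s≤s z≤n) (≤-reflexive (sym ([1+k]C2≡k+kC2 (suc k))))

2*[1+k]C2≡k*[1+k] : ∀ k → 2 * (suc k C 2) ≡ k * suc k
2*[1+k]C2≡k*[1+k] zero    = refl
2*[1+k]C2≡k*[1+k] (suc k) = begin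
  2 * (suc (suc k) C 2)        ≡⟨ cong (2 *_) ([1+k]C2≡k+kC2 (suc k)) ⟩
  2 * (suc k + suc k C 2)      ≡⟨ *-distribˡ-+ 2 (suc k) (suc k C 2) ⟩
  2 * suc k + 2 * (suc k C 2)  ≡⟨ cong (λ t → 2 * suc k + t) (2*[1+k]C2≡k*[1+k] k) ⟩
  2 * suc k + k * suc k        ≡⟨ *-distribʳ-+ (suc k) 2 k ⟨
  (2 + k) * suc k              ≡⟨ *-comm (2 + k) (suc k) ⟩
  suc k * suc (suc k)          ∎
  where open ≡-Reasoning

2*kC2+k≡k*k : ∀ k → 2 * (k C 2) + k ≡ k * k
2*kC2+k≡k*k zero    = refl
2*kC2+k≡k*k (suc k) = trans (cong (_+ suc k) (2*[1+k]C2≡k*[1+k] k)) (+-comm (k * suc k) (suc k))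

[m+n]C2≡mC2+nC2+m*n : ∀ m n → (m + n) C 2 ≡ m C 2 + n C 2 + m * n
[m+n]C2≡mC2+nC2+m*n zero    n = sym (+-identityʳ (n C 2))
[m+n]C2≡mC2+nC2+m*n (suc m) n = begin
  suc (m + n) C 2                     ≡⟨ [1+k]C2≡k+kC2 (m + n) ⟩
  m + n + (m + n) C 2                 ≡⟨ cong (λ t → m + n + t) ([m+n]C2≡mC2+nC2+m*n m n) ⟩
  m + n + (m C 2 + n C 2 + m * n)     ≡⟨ solve 5 (λ m n a b c → m :+ n :+ (a :+ b :+ c) := m :+ a :+ b :+ (n :+ c))
                                               refl m n (m C 2) (n C 2) (m * n) ⟩
  m + m C 2 + n C 2 + (n + m * n)     ≡⟨ cong (λ t → t + n C 2 + suc m * n) ([1+k]C2≡k+kC2 m) ⟨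
  suc m C 2 + n C 2 + suc m * n       ∎
  where
  open ≡-Reasoning
  open +-*-Solver

[1+m*d]C2≡d*[1+m]C2+m*m*dC2 : ∀ m d → suc (m * d) C 2 ≡ d * (suc m C 2) + m * m * (d C 2)
[1+m*d]C2≡d*[1+m]C2+m*m*dC2 m d = *-cancelˡ-≡ _ _ 2 (+-cancelʳ-≡ _ _ _ (begin
  2 * (suc (m * d) C 2) + m * m * d
    ≡⟨ cong (_+ m * m * d) (2*[1+k]C2≡k*[1+k] (m * d)) ⟩
  m * d * suc (m * d) + m * m * d
    ≡⟨ solve 2 (λ m d → m :* d :* (con 1 :+ m :* d) :+ m :* m :* d
                      := d :* (m :* (con 1 :+ m)) :+ m :* m :* (d :* d)) refl m d ⟩
  d * (m * suc m) + m * m * (d * d)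
    ≡⟨ cong₂ (λ a b → d * a + m * m * b) (2*[1+k]C2≡k*[1+k] m) (2*kC2+k≡k*k d) ⟨
  d * (2 * (suc m C 2)) + m * m * (2 * (d C 2) + d)
    ≡⟨ solve 4 (λ m d a b → d :* (con 2 :* a) :+ m :* m :* (con 2 :* b :+ d)
                          := con 2 :* (d :* a :+ m :* m :* b) :+ m :* m :* d)
               refl m d (suc m C 2) (d C 2) ⟩
  2 * (d * (suc m C 2) + m * m * (d C 2)) + m * m * d ∎))
  where
  open ≡-Reasoning
  open +-*-Solver

n≤2*[n∸1] : ∀ {n} → 1 < n → n ≤ 2 * (n ∸ 1)
n≤2*[n∸1] {suc n} (s≤s 1≤n) = begin
  suc n  ≡⟨ +-comm 1 n ⟩
  n + 1  ≤⟨ +-monoʳ-≤ n 1≤n ⟩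
  n + n  ≡⟨ cong (λ t → n + t) (+-identityʳ n) ⟨
  2 * n  ∎
  where open ≤-Reasoning

1<m⇒1<m^n : ∀ {m n} → 1 < m → 0 < n → 1 < m ^ n
1<m⇒1<m^n {m} {suc n} 1<m _ = ≤-trans 1<m (m≤m*n m (m ^ n) {{m^n≢0 m n {{>-nonZero (<⇒≤ 1<m)}}}})

1<m⇒m^n∸1≢0 : ∀ {m n} → 1 < m → 0 < n → NonZero (m ^ n ∸ 1)
1<m⇒m^n∸1≢0 1<m 0<n = >-nonZero (∸-monoˡ-≤ 1 (1<m⇒1<m^n 1<m 0<n))

prod1ℕ : ℕ → (ℕ → ℕ) → ℕ
prod1ℕ zero    f = 1
prod1ℕ (suc n) f = prod1ℕ n f * f (suc n)

qintℕ : ℕ → ℕ → ℕ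
qintℕ zero    x = 0
qintℕ (suc m) x = qintℕ m x + x ^ m

qfactℕ : ℕ → ℕ → ℕ
qfactℕ m x = prod1ℕ m (λ i → qintℕ i x)

prod1ℕ≢0 : ∀ n f → (∀ i → NonZero (f (suc i))) → NonZero (prod1ℕ n f)
prod1ℕ≢0 zero    f f≢0 = _
prod1ℕ≢0 (suc n) f f≢0 = m*n≢0 _ _ {{prod1ℕ≢0 n f f≢0}} {{f≢0 n}}

qfactℕ≢0 : ∀ m x .{{_ : NonZero x}} → NonZero (qfactℕ m x)
qfactℕ≢0 m x = prod1ℕ≢0 m _ (λ i → >-nonZero (≤-trans (m^n>0 x i) (m≤n+m (x ^ i) (qintℕ i x))))

q^[1+n]C2≤2^n*∏[q^i∸1] : ∀ q n → 1 < q → q ^ (suc n C 2) ≤ 2 ^ n * prod1ℕ n (λ i → q ^ i ∸ 1)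
q^[1+n]C2≤2^n*∏[q^i∸1] q zero    _   = ≤-refl
q^[1+n]C2≤2^n*∏[q^i∸1] q (suc n) 1<q = begin
  q ^ (suc (suc n) C 2)                      ≡⟨ cong (q ^_) ([1+k]C2≡k+kC2 (suc n)) ⟩
  q ^ (suc n + suc n C 2)                    ≡⟨ ^-distribˡ-+-* q (suc n) (suc n C 2) ⟩
  q ^ suc n * q ^ (suc n C 2)                ≤⟨ *-mono-≤ (n≤2*[n∸1] (1<m⇒1<m^n {n = suc n} 1<q (s≤s z≤n)))
                                                         (q^[1+n]C2≤2^n*∏[q^i∸1] q n 1<q) ⟩
  2 * (q ^ suc n ∸ 1) * (2 ^ n * P)          ≡⟨ solve 3 (λ a b p → con 2 :* a :* (b :* p) := con 2 :* b :* (p :* a))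
                                                        refl (q ^ suc n ∸ 1) (2 ^ n) P ⟩
  2 ^ suc n * (P * (q ^ suc n ∸ 1))          ∎
  where
  open +-*-Solver
  open ≤-Reasoning
  P = prod1ℕ n (λ i → q ^ i ∸ 1)

∏[q^[j*d]∸1]≤q^[d*[1+m]C2] : ∀ q d m → prod1ℕ m (λ j → q ^ (j * d) ∸ 1) ≤ q ^ (d * (suc m C 2))
∏[q^[j*d]∸1]≤q^[d*[1+m]C2] q d zero    = ≤-reflexive (cong (q ^_) (sym (*-zeroʳ d)))
∏[q^[j*d]∸1]≤q^[d*[1+m]C2] q d (suc m) = begin
  prod1ℕ m (λ j → q ^ (j * d) ∸ 1) * (q ^ (suc m * d) ∸ 1)
    ≤⟨ *-mono-≤ (∏[q^[j*d]∸1]≤q^[d*[1+m]C2] q d m) (m∸n≤m _ 1) ⟩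
  q ^ (d * (suc m C 2)) * q ^ (suc m * d)
    ≡⟨ ^-distribˡ-+-* q (d * (suc m C 2)) (suc m * d) ⟨
  q ^ (d * (suc m C 2) + suc m * d)
    ≡⟨ cong (q ^_) (solve 3 (λ d t m → d :* t :+ m :* d := d :* (m :+ t)) refl d (suc m C 2) (suc m)) ⟩
  q ^ (d * (suc m + suc m C 2))
    ≡⟨ cong (λ t → q ^ (d * t)) ([1+k]C2≡k+kC2 (suc m)) ⟨
  q ^ (d * (suc (suc m) C 2)) ∎
  where
  open ≤-Reasoning
  open +-*-Solver

x^[aC2]≤qfactℕ : ∀ x a → x ^ (a C 2) ≤ qfactℕ a x
x^[aC2]≤qfactℕ x zero    = ≤-refl
x^[aC2]≤qfactℕ x (suc a) = begin
  x ^ (suc a C 2)        ≡⟨ cong (x ^_) (trans ([1+k]C2≡k+kC2 a) (+-comm a (a C 2))) ⟩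
  x ^ (a C 2 + a)        ≡⟨ ^-distribˡ-+-* x (a C 2) a ⟩
  x ^ (a C 2) * x ^ a    ≤⟨ *-mono-≤ (x^[aC2]≤qfactℕ x a) (m≤n+m (x ^ a) (qintℕ a x)) ⟩
  qfactℕ (suc a) x       ∎
  where open ≤-Reasoning

qintℕ[1+k]≤2*x^k : ∀ x k → 1 < x → qintℕ (suc k) x ≤ 2 * x ^ k
qintℕ[1+k]≤2*x^k x zero    _   = s≤s z≤n
qintℕ[1+k]≤2*x^k x (suc k) 1<x = begin
  qintℕ (suc k) x + x ^ suc k  ≤⟨ +-monoˡ-≤ (x ^ suc k) (qintℕ[1+k]≤2*x^k x k 1<x) ⟩
  2 * x ^ k + x ^ suc k        ≤⟨ +-monoˡ-≤ (x ^ suc k) (*-monoˡ-≤ (x ^ k) 1<x) ⟩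
  x ^ suc k + x ^ suc k        ≡⟨ cong (λ t → x ^ suc k + t) (+-identityʳ (x ^ suc k)) ⟨
  2 * x ^ suc k                ∎
  where open ≤-Reasoning

qfactℕ≤2^r*x^[rC2] : ∀ x r → 1 < x → qfactℕ r x ≤ 2 ^ r * x ^ (r C 2)
qfactℕ≤2^r*x^[rC2] x zero    _   = ≤-refl
qfactℕ≤2^r*x^[rC2] x (suc r) 1<x = begin
  qfactℕ r x * qintℕ (suc r) x     ≤⟨ *-mono-≤ (qfactℕ≤2^r*x^[rC2] x r 1<x) (qintℕ[1+k]≤2*x^k x r 1<x) ⟩
  2 ^ r * x ^ (r C 2) * (2 * x ^ r) ≡⟨ solve 3 (λ a b c → a :* b :* (con 2 :* c) := con 2 :* a :* (c :* b))
                                              refl (2 ^ r) (x ^ (r C 2)) (x ^ r) ⟩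
  2 ^ suc r * (x ^ r * x ^ (r C 2)) ≡⟨ cong (2 ^ suc r *_) (^-distribˡ-+-* x r (r C 2)) ⟨
  2 ^ suc r * x ^ (r + r C 2)       ≡⟨ cong (λ t → 2 ^ suc r * x ^ t) ([1+k]C2≡k+kC2 r) ⟨
  2 ^ suc r * x ^ (suc r C 2)       ∎
  where
  open ≤-Reasoning
  open +-*-Solver

numerator denominator : (q d r s : ℕ) → ℕ
numerator q d r s =
  q ^ (d * (suc r C 2)) * prod1ℕ (suc (r + s) * d) (λ i → q ^ i ∸ 1) * qfactℕ (r + s) (q ^ d)
denominator q d r s =
  prod1ℕ (suc (r + s)) (λ j → q ^ (j * d) ∸ 1) * (qfactℕ r (q ^ d) * qfactℕ s (q ^ d))

exponent : (d r s : ℕ) → ℕ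
exponent d r s = d * (suc r C 2) + suc (r + s) * suc (r + s) * (d C 2) + d * r * s

exponent-spec : ∀ d r s →
  exponent d r s + d * (suc (suc (r + s)) C 2) ≡ d * (suc r C 2) + suc (suc (r + s) * d) C 2 + d * r * s
exponent-spec d r s = begin
  a + m * m * (d C 2) + d * r * s + d * (suc m C 2)
    ≡⟨ solve 4 (λ a b c t → a :+ b :+ c :+ t := a :+ (t :+ b) :+ c) refl a (m * m * (d C 2)) (d * r * s) (d * (suc m C 2)) ⟩
  a + (d * (suc m C 2) + m * m * (d C 2)) + d * r * s
    ≡⟨ cong (λ t → a + t + d * r * s) ([1+m*d]C2≡d*[1+m]C2+m*m*dC2 m d) ⟨
  a + suc (m * d) C 2 + d * r * s ∎
  where
  open +-*-Solver
  open ≡-Reasoning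
  m = suc (r + s)
  a = d * (suc r C 2)

exponent-balance : ∀ d r s →
  exponent d r s + (d * (suc (suc (r + s)) C 2) + d * (r C 2 + s C 2))
    ≡ d * (suc r C 2) + suc (suc (r + s) * d) C 2 + d * ((r + s) C 2)
exponent-balance d r s = begin
  exponent d r s + (d * (suc m C 2) + d * (r C 2 + s C 2))
    ≡⟨ +-assoc (exponent d r s) _ _ ⟨
  exponent d r s + d * (suc m C 2) + d * (r C 2 + s C 2)
    ≡⟨ cong (_+ d * (r C 2 + s C 2)) (exponent-spec d r s) ⟩
  a + b + d * r * s + d * (r C 2 + s C 2)
    ≡⟨ solve 7 (λ a b d r s x y → a :+ b :+ d :* r :* s :+ d :* (x :+ y) := a :+ b :+ d :* (x :+ y :+ r :* s))
               refl a b d r s (r C 2) (s C 2) ⟩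
  a + b + d * (r C 2 + s C 2 + r * s)
    ≡⟨ cong (λ t → a + b + d * t) ([m+n]C2≡mC2+nC2+m*n r s) ⟨
  a + b + d * ((r + s) C 2) ∎
  where
  open +-*-Solver
  open ≡-Reasoning
  m = suc (r + s)
  a = d * (suc r C 2)
  b = suc (m * d) C 2

exponent-pos : ∀ d r s → .{{_ : NonZero d}} → ¬ (d ≡ 1 × r ≡ 0) → 0 < exponent d r s
exponent-pos d (suc r) s _ = begin
  1                                         ≤⟨ *-mono-≤ (>-nonZero⁻¹ d) (0<[2+k]C2 r) ⟩
  d * (suc (suc r) C 2)                     ≤⟨ m≤m+n _ _ ⟩
  d * (suc (suc r) C 2) + m * m * (d C 2)   ≤⟨ m≤m+n _ _ ⟩
  exponent d (suc r) s                      ∎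
  where
  open ≤-Reasoning
  m = suc (suc r + s)
exponent-pos (suc zero)    zero s d≢1 = contradiction (refl , refl) d≢1
exponent-pos (suc (suc d)) zero s _   = begin
  1                                               ≤⟨ *-mono-≤ {1} {suc s * suc s} (s≤s z≤n) (0<[2+k]C2 d) ⟩
  suc s * suc s * (suc (suc d) C 2)               ≤⟨ m≤n+m _ (suc (suc d) * (1 C 2)) ⟩
  suc (suc d) * (1 C 2) + suc s * suc s * (suc (suc d) C 2) ≤⟨ m≤m+n _ _ ⟩
  exponent (suc (suc d)) zero s                   ∎
  where open ≤-Reasoning

denominator-upper-bound : ∀ q d r s → 1 < q → .{{_ : NonZero d}} →
  denominator q d r s ≤ 2 ^ (r + s) * q ^ (d * (suc (suc (r + s)) C 2) + d * (r C 2 + s C 2))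
denominator-upper-bound q d r s 1<q = begin
  prod1ℕ m (λ j → q ^ (j * d) ∸ 1) * (qfactℕ r x * qfactℕ s x)
    ≤⟨ *-mono-≤ (∏[q^[j*d]∸1]≤q^[d*[1+m]C2] q d m)
                (*-mono-≤ (qfactℕ≤2^r*x^[rC2] x r 1<x) (qfactℕ≤2^r*x^[rC2] x s 1<x)) ⟩
  a * (2 ^ r * x ^ (r C 2) * (2 ^ s * x ^ (s C 2)))
    ≡⟨ solve 5 (λ a b c d e → a :* (b :* c :* (d :* e)) := b :* d :* (a :* (c :* e)))
               refl a (2 ^ r) (x ^ (r C 2)) (2 ^ s) (x ^ (s C 2)) ⟩
  2 ^ r * 2 ^ s * (a * (x ^ (r C 2) * x ^ (s C 2)))
    ≡⟨ cong₂ (λ u v → u * (a * v)) (^-distribˡ-+-* 2 r s) (^-distribˡ-+-* x (r C 2) (s C 2)) ⟨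
  2 ^ (r + s) * (a * x ^ (r C 2 + s C 2))
    ≡⟨ cong (λ v → 2 ^ (r + s) * (a * v)) (^-*-assoc q d (r C 2 + s C 2)) ⟩
  2 ^ (r + s) * (a * q ^ (d * (r C 2 + s C 2)))
    ≡⟨ cong (2 ^ (r + s) *_) (^-distribˡ-+-* q (d * (suc m C 2)) (d * (r C 2 + s C 2))) ⟨
  2 ^ (r + s) * q ^ (d * (suc m C 2) + d * (r C 2 + s C 2)) ∎
  where
  open +-*-Solver
  open ≤-Reasoning
  m = suc (r + s)
  x = q ^ d
  a = q ^ (d * (suc m C 2))
  1<x : 1 < x
  1<x = 1<m⇒1<m^n 1<q (>-nonZero⁻¹ d)

numerator-lower-bound : ∀ q d r s → 1 < q →
  q ^ (d * (suc r C 2) + suc (suc (r + s) * d) C 2 + d * ((r + s) C 2)) ≤ 2 ^ (suc (r + s) * d) * numerator q d r s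
numerator-lower-bound q d r s 1<q = begin
  q ^ (a + suc n C 2 + d * ((r + s) C 2))
    ≡⟨ ^-distribˡ-+-* q (a + suc n C 2) (d * ((r + s) C 2)) ⟩
  q ^ (a + suc n C 2) * q ^ (d * ((r + s) C 2))
    ≡⟨ cong₂ _*_ (^-distribˡ-+-* q a (suc n C 2)) (sym (^-*-assoc q d ((r + s) C 2))) ⟩
  q ^ a * q ^ (suc n C 2) * (q ^ d) ^ ((r + s) C 2)
    ≤⟨ *-mono-≤ (*-monoʳ-≤ (q ^ a) (q^[1+n]C2≤2^n*∏[q^i∸1] q n 1<q)) (x^[aC2]≤qfactℕ (q ^ d) (r + s)) ⟩
  q ^ a * (2 ^ n * P) * F
    ≡⟨ solve 4 (λ a t p f → a :* (t :* p) :* f := t :* (a :* p :* f)) refl (q ^ a) (2 ^ n) P F ⟩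
  2 ^ n * numerator q d r s ∎
  where
  open +-*-Solver
  open ≤-Reasoning
  n = suc (r + s) * d
  a = d * (suc r C 2)
  P = prod1ℕ n (λ i → q ^ i ∸ 1)
  F = qfactℕ (r + s) (q ^ d)

q^exponent*denominator≤2^[r+s+n]*numerator : ∀ q d r s → 1 < q → .{{_ : NonZero d}} →
  q ^ exponent d r s * denominator q d r s ≤ 2 ^ (r + s) * 2 ^ (suc (r + s) * d) * numerator q d r s
q^exponent*denominator≤2^[r+s+n]*numerator q d r s 1<q = begin
  q ^ E * denominator q d r s
    ≤⟨ *-monoʳ-≤ (q ^ E) (denominator-upper-bound q d r s 1<q) ⟩
  q ^ E * (2 ^ (r + s) * q ^ X)
    ≡⟨ x∙yz≈y∙xz (q ^ E) (2 ^ (r + s)) (q ^ X) ⟩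
  2 ^ (r + s) * (q ^ E * q ^ X)
    ≡⟨ cong (2 ^ (r + s) *_) (trans (sym (^-distribˡ-+-* q E X)) (cong (q ^_) (exponent-balance d r s))) ⟩
  2 ^ (r + s) * q ^ (d * (suc r C 2) + suc (suc (r + s) * d) C 2 + d * ((r + s) C 2))
    ≤⟨ *-monoʳ-≤ (2 ^ (r + s)) (numerator-lower-bound q d r s 1<q) ⟩
  2 ^ (r + s) * (2 ^ (suc (r + s) * d) * numerator q d r s)
    ≡⟨ *-assoc (2 ^ (r + s)) _ _ ⟨
  2 ^ (r + s) * 2 ^ (suc (r + s) * d) * numerator q d r s ∎
  where
  open ≤-Reasoning
  open import Algebra.Properties.CommutativeSemigroup *-commutativeSemigroup using (x∙yz≈y∙xz)
  E = exponent d r s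
  X = d * (suc (suc (r + s)) C 2) + d * (r C 2 + s C 2)

ℕ→ℚ≡mkℚ : ∀ n → ℕ→ℚ n ≡ ℚ.mkℚ (+ n) 0 (coprime-sym (1-coprimeTo n))
ℕ→ℚ≡mkℚ n = ℚP.normalize-coprime (coprime-sym (1-coprimeTo n))

ℕ→ℚ-homo-* : ∀ m n → ℕ→ℚ (m * n) ≡ ℕ→ℚ m ℚ.* ℕ→ℚ n
ℕ→ℚ-homo-* m n rewrite ℕ→ℚ≡mkℚ m | ℕ→ℚ≡mkℚ n = cong (ℚ._/ 1) (ℤP.pos-* m n)

ℕ→ℚ-homo-+ : ∀ m n → ℕ→ℚ (m + n) ≡ ℕ→ℚ m ℚ.+ ℕ→ℚ n
ℕ→ℚ-homo-+ m n rewrite ℕ→ℚ≡mkℚ m | ℕ→ℚ≡mkℚ n =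
  cong (ℚ._/ 1) (trans (ℤP.pos-+ m n) (sym (cong₂ ℤ._+_ (ℤP.*-identityʳ (+ m)) (ℤP.*-identityʳ (+ n)))))

ℕ→ℚ-mono-≤ : ∀ {m n} → m ≤ n → ℕ→ℚ m ℚ.≤ ℕ→ℚ n
ℕ→ℚ-mono-≤ {m} {n} m≤n rewrite ℕ→ℚ≡mkℚ m | ℕ→ℚ≡mkℚ n =
  ℚ.*≤* (subst₂ ℤ._≤_ (sym (ℤP.*-identityʳ (+ m))) (sym (ℤP.*-identityʳ (+ n))) (ℤ.+≤+ m≤n))

ℕ→ℚ-pos : ∀ n .{{_ : NonZero n}} → Positive (ℕ→ℚ n)
ℕ→ℚ-pos n = ℚP.normalize-pos n 1

ℕ→ℚ-pred : ∀ n .{{_ : NonZero n}} → ℕ→ℚ (n ∸ 1) ≡ ℕ→ℚ n ℚ.- 1ℚ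
ℕ→ℚ-pred (suc n) = begin
  ℕ→ℚ n                      ≡⟨ ℚP.+-identityʳ (ℕ→ℚ n) ⟨
  ℕ→ℚ n ℚ.+ 0ℚ               ≡⟨ cong (ℕ→ℚ n ℚ.+_) (ℚP.+-inverseʳ 1ℚ) ⟨
  ℕ→ℚ n ℚ.+ (1ℚ ℚ.- 1ℚ)      ≡⟨ ℚP.+-assoc (ℕ→ℚ n) 1ℚ (ℚ.- 1ℚ) ⟨
  ℕ→ℚ n ℚ.+ 1ℚ ℚ.- 1ℚ        ≡⟨ cong (ℚ._- 1ℚ) (trans (cong ℕ→ℚ (+-comm 1 n)) (ℕ→ℚ-homo-+ n 1)) ⟨
  ℕ→ℚ (suc n) ℚ.- 1ℚ         ∎
  where open ≡-Reasoning

pow-ℕ→ℚ : ∀ q k → pow (ℕ→ℚ q) k ≡ ℕ→ℚ (q ^ k)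
pow-ℕ→ℚ q zero    = refl
pow-ℕ→ℚ q (suc k) = trans (cong (ℕ→ℚ q ℚ.*_) (pow-ℕ→ℚ q k)) (sym (ℕ→ℚ-homo-* q (q ^ k)))

prod1-ℕ→ℚ : ∀ n f g → (∀ i → f i ≡ ℕ→ℚ (g i)) → prod1 n f ≡ ℕ→ℚ (prod1ℕ n g)
prod1-ℕ→ℚ zero    f g f≡g = refl
prod1-ℕ→ℚ (suc n) f g f≡g =
  trans (cong₂ ℚ._*_ (prod1-ℕ→ℚ n f g f≡g) (f≡g (suc n))) (sym (ℕ→ℚ-homo-* (prod1ℕ n g) (g (suc n))))

qint-ℕ→ℚ : ∀ m x → qint m (ℕ→ℚ x) ≡ ℕ→ℚ (qintℕ m x)
qint-ℕ→ℚ zero    x = refl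
qint-ℕ→ℚ (suc m) x =
  trans (cong₂ ℚ._+_ (qint-ℕ→ℚ m x) (pow-ℕ→ℚ x m)) (sym (ℕ→ℚ-homo-+ (qintℕ m x) (x ^ m)))

qfact-ℕ→ℚ : ∀ m x → qfact m (ℕ→ℚ x) ≡ ℕ→ℚ (qfactℕ m x)
qfact-ℕ→ℚ m x = prod1-ℕ→ℚ m _ _ (λ i → qint-ℕ→ℚ i x)

pow-ℕ→ℚ-pred : ∀ q .{{_ : NonZero q}} k → pow (ℕ→ℚ q) k ℚ.- 1ℚ ≡ ℕ→ℚ (q ^ k ∸ 1)
pow-ℕ→ℚ-pred q k = trans (cong (ℚ._- 1ℚ) (pow-ℕ→ℚ q k)) (sym (ℕ→ℚ-pred (q ^ k) {{m^n≢0 q k}}))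

zpow-ℕ→ℚ-neg : ∀ q k → zpow (ℕ→ℚ q) (ℤ.- + k) ≡ inv (ℕ→ℚ (q ^ k))
zpow-ℕ→ℚ-neg q zero    = refl
zpow-ℕ→ℚ-neg q (suc k) = cong inv (pow-ℕ→ℚ q (suc k))

inv-unique : ∀ p {r} → p ℚ.* r ≡ 1ℚ → inv p ≡ r
inv-unique p {r} pr≡1 with p ℚP.≟ 0ℚ
... | yes refl = contradiction (trans (sym (ℚP.*-zeroˡ r)) pr≡1) λ ()
... | no p≢0 = begin
  1/p                    ≡⟨ ℚP.*-identityʳ 1/p ⟨
  1/p ℚ.* 1ℚ             ≡⟨ cong (1/p ℚ.*_) pr≡1 ⟨
  1/p ℚ.* (p ℚ.* r)      ≡⟨ ℚP.*-assoc 1/p p r ⟨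
  1/p ℚ.* p ℚ.* r        ≡⟨ cong (ℚ._* r) (ℚP.*-inverseˡ p) ⟩
  1ℚ ℚ.* r               ≡⟨ ℚP.*-identityˡ r ⟩
  r                      ∎
  where
  open ≡-Reasoning
  instance _ = ℚ.≢-nonZero p≢0
  1/p = ℚ.1/ p

ℕ→ℚ-*-inv : ∀ n .{{_ : NonZero n}} → ℕ→ℚ n ℚ.* inv (ℕ→ℚ n) ≡ 1ℚ
ℕ→ℚ-*-inv n = trans (cong (ℕ→ℚ n ℚ.*_) (inv-unique (ℕ→ℚ n) (ℚP.*-inverseʳ (ℕ→ℚ n)))) (ℚP.*-inverseʳ (ℕ→ℚ n))
  where instance _ = ℚP.pos⇒nonZero (ℕ→ℚ n) {{ℕ→ℚ-pos n}}

*-cancel-inverse : ∀ x y z {z′} → z ℚ.* z′ ≡ 1ℚ → x ℚ.* z′ ℚ.* (z ℚ.* y) ≡ x ℚ.* y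
*-cancel-inverse x y z {z′} zz′≡1 = begin
  x ℚ.* z′ ℚ.* (z ℚ.* y)     ≡⟨ solve 4 (λ x y z z′ → x :* z′ :* (z :* y) := x :* y :* (z :* z′)) refl x y z z′ ⟩
  x ℚ.* y ℚ.* (z ℚ.* z′)     ≡⟨ cong (x ℚ.* y ℚ.*_) zz′≡1 ⟩
  x ℚ.* y ℚ.* 1ℚ             ≡⟨ ℚP.*-identityʳ (x ℚ.* y) ⟩
  x ℚ.* y                    ∎
  where
  open ≡-Reasoning
  open ℚSolver.+-*-Solver

fraction-mono-≤ : ∀ a b c d .{{_ : NonZero b}} .{{_ : NonZero d}} → a * d ≤ c * b →
  ℕ→ℚ a ℚ.* inv (ℕ→ℚ b) ℚ.≤ ℕ→ℚ c ℚ.* inv (ℕ→ℚ d)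
fraction-mono-≤ a b c d ad≤cb = ℚP.*-cancelʳ-≤-pos (ℕ→ℚ b ℚ.* ℕ→ℚ d) (begin
  ℕ→ℚ a ℚ.* inv (ℕ→ℚ b) ℚ.* (ℕ→ℚ b ℚ.* ℕ→ℚ d) ≡⟨ *-cancel-inverse (ℕ→ℚ a) (ℕ→ℚ d) (ℕ→ℚ b) (ℕ→ℚ-*-inv b) ⟩
  ℕ→ℚ a ℚ.* ℕ→ℚ d                             ≡⟨ ℕ→ℚ-homo-* a d ⟨
  ℕ→ℚ (a * d)                                 ≤⟨ ℕ→ℚ-mono-≤ ad≤cb ⟩
  ℕ→ℚ (c * b)                                 ≡⟨ ℕ→ℚ-homo-* c b ⟩
  ℕ→ℚ c ℚ.* ℕ→ℚ b                             ≡⟨ *-cancel-inverse (ℕ→ℚ c) (ℕ→ℚ b) (ℕ→ℚ d) (ℕ→ℚ-*-inv d) ⟨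
  ℕ→ℚ c ℚ.* inv (ℕ→ℚ d) ℚ.* (ℕ→ℚ d ℚ.* ℕ→ℚ b) ≡⟨ cong (ℕ→ℚ c ℚ.* inv (ℕ→ℚ d) ℚ.*_) (ℚP.*-comm (ℕ→ℚ d) (ℕ→ℚ b)) ⟩
  ℕ→ℚ c ℚ.* inv (ℕ→ℚ d) ℚ.* (ℕ→ℚ b ℚ.* ℕ→ℚ d) ∎)
  where
  open ℚP.≤-Reasoning
  instance
    _ : Positive (ℕ→ℚ b ℚ.* ℕ→ℚ d)
    _ = ℚP.pos*pos⇒pos (ℕ→ℚ b) {{ℕ→ℚ-pos b}} (ℕ→ℚ d) {{ℕ→ℚ-pos d}}

inv-≤-fraction : ∀ x a b c d .{{_ : NonZero a}} .{{_ : NonZero b}} .{{_ : NonZero d}} →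
  x ℚ.* ℕ→ℚ a ≡ ℕ→ℚ b → d * a ≤ c * b → inv x ℚ.≤ ℕ→ℚ c ℚ.* inv (ℕ→ℚ d)
inv-≤-fraction x a b c d xa≡b da≤cb = begin
  inv x                          ≡⟨ inv-unique x x*a/b≡1 ⟩
  ℕ→ℚ a ℚ.* inv (ℕ→ℚ b)          ≤⟨ fraction-mono-≤ a b c d (subst (_≤ c * b) (*-comm d a) da≤cb) ⟩
  ℕ→ℚ c ℚ.* inv (ℕ→ℚ d)          ∎
  where
  open ℚP.≤-Reasoning
  x*a/b≡1 : x ℚ.* (ℕ→ℚ a ℚ.* inv (ℕ→ℚ b)) ≡ 1ℚ
  x*a/b≡1 = trans (sym (ℚP.*-assoc x (ℕ→ℚ a) _)) (trans (cong (ℚ._* inv (ℕ→ℚ b)) xa≡b) (ℕ→ℚ-*-inv b))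

-- deg and e with n / d abstracted to k, so that for n = m·d the quotient can be replaced by m.
deg′ : (n d k r : ℕ) → ℚ → ℚ
deg′ n d k r q =
  pow q (d * (suc r C 2))
  ℚ.* (prod1 n (λ i → pow q i ℚ.- 1ℚ) ℚ.* inv (prod1 k (λ j → pow q (j * d) ℚ.- 1ℚ)))
  ℚ.* qbinom (k ∸ 1) r (pow q d)

e′ : (n d k r : ℕ) → ℤ
e′ n d k r =
  + (d * (suc r C 2)) ℤ.+ + (suc n C 2) ℤ.- + (d * (suc k C 2))
  ℤ.+ (+ d ℤ.* + r ℤ.* (+ k ℤ.- ℤ.1ℤ ℤ.- + r))

deg′-ℕ→ℚ : ∀ q d r s .{{_ : NonZero q}} →
  deg′ (suc (r + s) * d) d (suc (r + s)) r (ℕ→ℚ q)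
    ≡ ℕ→ℚ (q ^ (d * (suc r C 2)))
      ℚ.* (ℕ→ℚ (prod1ℕ (suc (r + s) * d) (λ i → q ^ i ∸ 1)) ℚ.* inv (ℕ→ℚ (prod1ℕ (suc (r + s)) (λ j → q ^ (j * d) ∸ 1))))
      ℚ.* (ℕ→ℚ (qfactℕ (r + s) (q ^ d)) ℚ.* inv (ℕ→ℚ (qfactℕ r (q ^ d) * qfactℕ s (q ^ d))))
deg′-ℕ→ℚ q d r s =
  cong₂ ℚ._*_
    (cong₂ ℚ._*_ (pow-ℕ→ℚ q (d * (suc r C 2)))
      (cong₂ (λ a b → a ℚ.* inv b)
        (prod1-ℕ→ℚ (suc (r + s) * d) (λ i → pow (ℕ→ℚ q) i ℚ.- 1ℚ) (λ i → q ^ i ∸ 1) (pow-ℕ→ℚ-pred q))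
        (prod1-ℕ→ℚ (suc (r + s)) (λ j → pow (ℕ→ℚ q) (j * d) ℚ.- 1ℚ) (λ j → q ^ (j * d) ∸ 1)
           (λ j → pow-ℕ→ℚ-pred q (j * d)))))
    (trans (cong (qbinom (r + s) r) (pow-ℕ→ℚ q d))
      (cong₂ (λ a b → a ℚ.* inv b) (qfact-ℕ→ℚ (r + s) x)
        (trans (cong₂ ℚ._*_ (qfact-ℕ→ℚ r x) (trans (cong (λ t → qfact t (ℕ→ℚ x)) (m+n∸m≡n r s)) (qfact-ℕ→ℚ s x)))
          (sym (ℕ→ℚ-homo-* (qfactℕ r x) (qfactℕ s x))))))
  where x = q ^ d

∏[q^[j*d]∸1]≢0 : ∀ q d m → 1 < q → .{{_ : NonZero d}} → NonZero (prod1ℕ m (λ j → q ^ (j * d) ∸ 1))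
∏[q^[j*d]∸1]≢0 q d m 1<q = prod1ℕ≢0 m _ (λ j → 1<m⇒m^n∸1≢0 1<q (≤-trans (>-nonZero⁻¹ d) (m≤n*m d (suc j))))

numerator≢0 : ∀ q d r s → 1 < q → NonZero (numerator q d r s)
numerator≢0 q d r s 1<q = m*n≢0 (A * P) (qfactℕ (r + s) x) {{m*n≢0 A P}}
  where
  x = q ^ d
  A = q ^ (d * (suc r C 2))
  P = prod1ℕ (suc (r + s) * d) (λ i → q ^ i ∸ 1)
  instance
    q≢0 = >-nonZero (<⇒≤ 1<q)
    A≢0 = m^n≢0 q (d * (suc r C 2))
    P≢0 = prod1ℕ≢0 (suc (r + s) * d) (λ i → q ^ i ∸ 1) (λ i → 1<m⇒m^n∸1≢0 {n = suc i} 1<q (s≤s z≤n))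
    F≢0 = qfactℕ≢0 (r + s) x {{m^n≢0 q d}}

deg′*denominator≡numerator : ∀ q d r s → 1 < q → .{{_ : NonZero d}} →
  deg′ (suc (r + s) * d) d (suc (r + s)) r (ℕ→ℚ q) ℚ.* ℕ→ℚ (denominator q d r s) ≡ ℕ→ℚ (numerator q d r s)
deg′*denominator≡numerator q d r s 1<q = begin
  deg′ (suc (r + s) * d) d (suc (r + s)) r (ℕ→ℚ q) ℚ.* ℕ→ℚ (B * GH)
    ≡⟨ cong₂ ℚ._*_ (deg′-ℕ→ℚ q d r s) (ℕ→ℚ-homo-* B GH) ⟩
  ι A ℚ.* (ι P ℚ.* inv (ι B)) ℚ.* (ι F ℚ.* inv (ι GH)) ℚ.* (ι B ℚ.* ι GH)
    ≡⟨ solve 7 (λ a p f b g b′ g′ → a :* (p :* b′) :* (f :* g′) :* (b :* g) := a :* p :* f :* (b :* b′ :* (g :* g′)))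
               refl (ι A) (ι P) (ι F) (ι B) (ι GH) (inv (ι B)) (inv (ι GH)) ⟩
  ι A ℚ.* ι P ℚ.* ι F ℚ.* (ι B ℚ.* inv (ι B) ℚ.* (ι GH ℚ.* inv (ι GH)))
    ≡⟨ cong₂ (λ u v → ι A ℚ.* ι P ℚ.* ι F ℚ.* (u ℚ.* v)) (ℕ→ℚ-*-inv B) (ℕ→ℚ-*-inv GH) ⟩
  ι A ℚ.* ι P ℚ.* ι F ℚ.* 1ℚ
    ≡⟨ ℚP.*-identityʳ _ ⟩
  ι A ℚ.* ι P ℚ.* ι F
    ≡⟨ trans (ℕ→ℚ-homo-* (A * P) F) (cong (ℚ._* ι F) (ℕ→ℚ-homo-* A P)) ⟨
  ι (A * P * F) ∎
  where
  open ≡-Reasoning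
  open ℚSolver.+-*-Solver
  ι = ℕ→ℚ
  x = q ^ d
  A = q ^ (d * (suc r C 2))
  P = prod1ℕ (suc (r + s) * d) (λ i → q ^ i ∸ 1)
  F = qfactℕ (r + s) x
  B = prod1ℕ (suc (r + s)) (λ j → q ^ (j * d) ∸ 1)
  GH = qfactℕ r x * qfactℕ s x
  instance
    q≢0 = >-nonZero (<⇒≤ 1<q)
    B≢0 = ∏[q^[j*d]∸1]≢0 q d (suc (r + s)) 1<q
    GH≢0 = m*n≢0 _ _ {{qfactℕ≢0 r x {{m^n≢0 q d}}}} {{qfactℕ≢0 s x {{m^n≢0 q d}}}}

denominator≢0 : ∀ q d r s → 1 < q → .{{_ : NonZero d}} → NonZero (denominator q d r s)
denominator≢0 q d r s 1<q =
  m*n≢0 _ _ {{∏[q^[j*d]∸1]≢0 q d (suc (r + s)) 1<q}} {{m*n≢0 _ _ {{qfactℕ≢0 r x}} {{qfactℕ≢0 s x}}}}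
  where
  x = q ^ d
  instance _ = m^n≢0 q d {{>-nonZero (<⇒≤ 1<q)}}

inv-deg′≤2^[r+s+n]*inv[q^exponent] : ∀ q d r s → 1 < q → .{{_ : NonZero d}} →
  inv (deg′ (suc (r + s) * d) d (suc (r + s)) r (ℕ→ℚ q))
    ℚ.≤ ℕ→ℚ (2 ^ (r + s) * 2 ^ (suc (r + s) * d)) ℚ.* inv (ℕ→ℚ (q ^ exponent d r s))
inv-deg′≤2^[r+s+n]*inv[q^exponent] q d r s 1<q =
  inv-≤-fraction (deg′ (suc (r + s) * d) d (suc (r + s)) r (ℕ→ℚ q))
    (denominator q d r s) (numerator q d r s) (2 ^ (r + s) * 2 ^ (suc (r + s) * d)) (q ^ exponent d r s)
    (deg′*denominator≡numerator q d r s 1<q) (q^exponent*denominator≤2^[r+s+n]*numerator q d r s 1<q)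
  where
  instance
    _ = denominator≢0 q d r s 1<q
    _ = numerator≢0 q d r s 1<q
    _ = m^n≢0 q (exponent d r s) {{>-nonZero (<⇒≤ 1<q)}}

e′-exponent : ∀ d r s → e′ (suc (r + s) * d) d (suc (r + s)) r ≡ + exponent d r s
e′-exponent d r s = begin
  a ℤ.+ b ℤ.- c ℤ.+ D ℤ.* R ℤ.* (+ m ℤ.- ℤ.1ℤ ℤ.- R)
    ≡⟨ cong (λ t → a ℤ.+ b ℤ.- c ℤ.+ D ℤ.* R ℤ.* (t ℤ.- ℤ.1ℤ ℤ.- R)) +m≡1+R+S ⟩
  a ℤ.+ b ℤ.- c ℤ.+ D ℤ.* R ℤ.* (ℤ.1ℤ ℤ.+ (R ℤ.+ S) ℤ.- ℤ.1ℤ ℤ.- R)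
    ≡⟨ solve 6 (λ a b c D R S → a :+ b :- c :+ D :* R :* (con ℤ.1ℤ :+ (R :+ S) :- con ℤ.1ℤ :- R)
                             := a :+ b :+ D :* R :* S :- c) refl a b c D R S ⟩
  a ℤ.+ b ℤ.+ D ℤ.* R ℤ.* S ℤ.- c
    ≡⟨ cong (ℤ._- c) E+c≡a+b+DRS ⟨
  + E ℤ.+ c ℤ.- c
    ≡⟨ solve 2 (λ e c → e :+ c :- c := e) refl (+ E) c ⟩
  + E ∎
  where
  open ≡-Reasoning
  open ℤSolver.+-*-Solver
  m = suc (r + s)
  E = exponent d r s
  a = + (d * (suc r C 2))
  b = + (suc (m * d) C 2)
  c = + (d * (suc m C 2))
  D = + d
  R = + r
  S = + s
  +m≡1+R+S : + m ≡ ℤ.1ℤ ℤ.+ (R ℤ.+ S)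
  +m≡1+R+S = trans (ℤP.pos-+ 1 (r + s)) (cong (λ t → ℤ.1ℤ ℤ.+ t) (ℤP.pos-+ r s))
  E+c≡a+b+DRS : + E ℤ.+ c ≡ a ℤ.+ b ℤ.+ D ℤ.* R ℤ.* S
  E+c≡a+b+DRS = begin
    + E ℤ.+ c                                     ≡⟨ ℤP.pos-+ E (d * (suc m C 2)) ⟨
    + (E + d * (suc m C 2))                       ≡⟨ cong +_ (exponent-spec d r s) ⟩
    + (d * (suc r C 2) + suc (m * d) C 2 + d * r * s)
      ≡⟨ trans (ℤP.pos-+ (d * (suc r C 2) + suc (m * d) C 2) (d * r * s))
               (cong₂ ℤ._+_ (ℤP.pos-+ (d * (suc r C 2)) (suc (m * d) C 2))
                            (trans (ℤP.pos-* (d * r) s) (cong (ℤ._* S) (ℤP.pos-* d r)))) ⟩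
    a ℤ.+ b ℤ.+ D ℤ.* R ℤ.* S                     ∎

e′[n,1,n,0]≡0 : ∀ n → e′ n 1 n 0 ≡ ℤ.0ℤ
e′[n,1,n,0]≡0 n rewrite *-identityˡ (suc n C 2) =
  solve 2 (λ t y → t :- t :+ con ℤ.0ℤ :* y := con ℤ.0ℤ) refl (+ (suc n C 2)) (+ n ℤ.- ℤ.1ℤ ℤ.- + 0)
  where open ℤSolver.+-*-Solver

deg′-bigO : ∀ d .{{_ : NonZero d}} r s →
  BigOPrimePowers (λ q → inv (deg′ (suc (r + s) * d) d (suc (r + s)) r (ℕ→ℚ q)))
                  (λ q → zpow (ℕ→ℚ q) (ℤ.- e′ (suc (r + s) * d) d (suc (r + s)) r))
deg′-bigO d r s = M , 1 , λ q _ 1<q → begin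
  inv (deg′ (suc (r + s) * d) d (suc (r + s)) r (ℕ→ℚ q))
    ≤⟨ inv-deg′≤2^[r+s+n]*inv[q^exponent] q d r s 1<q ⟩
  M ℚ.* inv (ℕ→ℚ (q ^ exponent d r s))
    ≡⟨ cong (M ℚ.*_) (zpow-ℕ→ℚ-neg q (exponent d r s)) ⟨
  M ℚ.* zpow (ℕ→ℚ q) (ℤ.- + exponent d r s)
    ≡⟨ cong (λ t → M ℚ.* zpow (ℕ→ℚ q) (ℤ.- t)) (e′-exponent d r s) ⟨
  M ℚ.* zpow (ℕ→ℚ q) (ℤ.- e′ (suc (r + s) * d) d (suc (r + s)) r) ∎
  where
  open ℚP.≤-Reasoning
  M = ℕ→ℚ (2 ^ (r + s) * 2 ^ (suc (r + s) * d))

split-quotient : ∀ {ℓ} (P : ℕ → ℕ → Set ℓ) {n d r} .{{_ : NonZero d}} → d ∣ n → r < n / d →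
                 (∀ s → P (suc (r + s) * d) (suc (r + s))) → P n (n / d)
split-quotient P {d = d} {r} (divides m refl) r<n/d Pₛ
  with s , refl ← m≤n⇒∃[o]m+o≡n (subst (r <_) (m*n/n≡m m d) r<n/d)
  = subst (P (m * d)) (sym (m*n/n≡m m d)) (Pₛ s)

inv-deg-bigO : (n d r : ℕ) → .{{_ : NonZero d}} → d ∣ n → r < n / d →
  BigOPrimePowers (λ q → inv (deg n d r (ℕ→ℚ q))) (λ q → zpow (ℕ→ℚ q) (ℤ.- e n d r))
inv-deg-bigO n d r d∣n r<n/d = split-quotient
  (λ n k → BigOPrimePowers (λ q → inv (deg′ n d k r (ℕ→ℚ q))) (λ q → zpow (ℕ→ℚ q) (ℤ.- e′ n d k r)))
  d∣n r<n/d (deg′-bigO d r)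

e-pos : (n d r : ℕ) → .{{_ : NonZero d}} → d ∣ n → r < n / d → ¬ (d ≡ 1 × r ≡ 0) → ℤ.0ℤ ℤ.< e n d r
e-pos n d r d∣n r<n/d d,r≢1,0 = split-quotient (λ n k → ℤ.0ℤ ℤ.< e′ n d k r) d∣n r<n/d
  (λ s → subst (ℤ.0ℤ ℤ.<_) (sym (e′-exponent d r s)) (ℤ.+<+ (exponent-pos d r s d,r≢1,0)))

e[n,1,0]≡0 : (n : ℕ) → e n 1 0 ≡ ℤ.0ℤ
e[n,1,0]≡0 n = subst (λ k → e′ n 1 k 0 ≡ ℤ.0ℤ) (sym (n/1≡n n)) (e′[n,1,n,0]≡0 n)

lemma5p1 : ((n d r : ℕ) → .{{_ : NonZero d}} → d ∣ n → r < n / d →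
              BigOPrimePowers (λ q → inv (deg n d r (ℕ→ℚ q)))
                              (λ q → zpow (ℕ→ℚ q) (ℤ.- e n d r)))
           × ((n d r : ℕ) → .{{_ : NonZero d}} → d ∣ n → r < n / d →
              ¬ (d ≡ 1 × r ≡ 0) → ℤ.0ℤ ℤ.< e n d r)
           × ((n : ℕ) → e n 1 0 ≡ ℤ.0ℤ)
lemma5p1 = inv-deg-bigO , e-pos , e[n,1,0]≡0
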